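{- Suppose that $n$ is a positive integer which is not a power of two. Then there are $x,y,z\in\mathbb{Z}$ with $|x|<n$, $|y|<n$ and $|z|<n$ such that $x^2+y^2+z^2=n^2$.
   Context: Powers of two include $2^0=1$. -}

module Defs where

open import Data.Nat using (ℕ; _^_)
open import Data.Product using (∃)
open import Relation.Binary.PropositionalEquality using (_≡_)

IsPowerOfTwo : ℕ → Set
IsPowerOfTwo n = ∃ λ (k : ℕ) → n ≡ 2 ^ k

{-# OPTIONS --safe #-}
module Submission where

open import Defs
open import Data.Nat using (ℕ; _<_)
open import Data.Integer using (ℤ; +_; _+_; _*_; ∣_∣)
open import Data.Product using (∃-syntax; _×_)
open import Relation.Binary.PropositionalEquality using (_≡_)
open import Relation.Nullary using (¬_)

open import Data.Empty using (⊥; ⊥-elim)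
open import Data.Fin using (toℕ; fromℕ<)
open import Data.Fin.Properties using (pigeonhole; toℕ-fromℕ<; toℕ<n)
open import Data.Integer using (_-_; -[1+_]; _%ℕ_; _/ℕ_; NonZero)
open import Data.Integer.DivMod using (n%ℕd<d; a≡a%ℕn+[a/ℕn]*n)
import Data.Integer.Properties as ℤ
open import Data.Integer.Tactic.RingSolver using (solve-∀)
open import Data.List using ([]; _∷_)
open import Data.List.Relation.Unary.All using (_∷_)
open import Data.Nat using (zero; suc; s≤s; z≤n; _∸_)
import Data.Nat as ℕ
open import Data.Nat.DivMod using (_%_; _/_; m≡m%n+[m/n]*n; m%n<n)
open import Data.Nat.Divisibility using (_∣_; divides; ∣-trans; ∣m+n∣m⇒∣n; n∣m*n; ∣⇒≤)
open import Data.Nat.Induction using (<-rec)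
open import Data.Nat.ListAction using (product)
open import Data.Nat.Primality
  using (Prime; composite; prime⇒¬composite; prime⇒nonTrivial; prime⇒irreducible; euclidsLemma)
open import Data.Nat.Primality.Factorisation using (factorise)
import Data.Nat.Properties as ℕ
import Data.Nat.Tactic.RingSolver as ℕ-Ring
open import Data.Product using (_,_)
open import Data.Sum using (_⊎_; inj₁; inj₂)
open import Relation.Binary.PropositionalEquality
  using (refl; sym; trans; cong; cong₂; subst; _≢_; module ≡-Reasoning)
open import Relation.Nullary using (yes; no)

-- n has an odd prime factor p, and scaling a solution for p by n / p gives one for n.
-- By Lagrange's four-square theorem p = a² + b² + c² + d², and since p is not a square
-- the terms can be arranged with a² + b² and c² + d² both positive. Then
--   p² = (a² + b² − c² − d²)² + (2(ad + bc))² + (2(bd − ac))²,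
-- where the first square is odd, hence positive, and the last two add up to
-- 4(a² + b²)(c² + d²) > 0, so each of the three squares is smaller than p².
-- Lagrange's theorem for p is proved by Euler's descent on m in m p = a² + b² + c² + d².

-- Parity

even⊎oddℕ : ∀ n → ∃[ k ] (n ≡ 2 ℕ.* k ⊎ n ≡ suc (2 ℕ.* k))
even⊎oddℕ zero = 0 , inj₁ refl
even⊎oddℕ (suc n) with even⊎oddℕ n
... | k , inj₁ refl = k , inj₂ refl
... | k , inj₂ refl = suc k , inj₁ (cong suc (sym (ℕ.+-suc k (k ℕ.+ 0))))

2*n≡n+n : ∀ n → 2 ℕ.* n ≡ n ℕ.+ n
2*n≡n+n n = cong (n ℕ.+_) (ℕ.+-identityʳ n)

even⊎oddℤ : ∀ i → ∃[ k ] (i ≡ + 2 * k ⊎ i ≡ + 2 * k + + 1)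
even⊎oddℤ i with i %ℕ 2 | n%ℕd<d i 2 | a≡a%ℕn+[a/ℕn]*n i 2
... | 0 | _ | i≡0+k*2 = i /ℕ 2 , inj₁ (trans i≡0+k*2 (0+k*2≡2*k (i /ℕ 2)))
  where 0+k*2≡2*k : ∀ k → + 0 + k * + 2 ≡ + 2 * k
        0+k*2≡2*k = solve-∀
... | 1 | _ | i≡1+k*2 = i /ℕ 2 , inj₂ (trans i≡1+k*2 (1+k*2≡2*k+1 (i /ℕ 2)))
  where 1+k*2≡2*k+1 : ∀ k → + 1 + k * + 2 ≡ + 2 * k + + 1
        1+k*2≡2*k+1 = solve-∀
... | suc (suc _) | s≤s (s≤s ()) | _

even≢oddℤ : ∀ i j → + 2 * i ≢ + 2 * j + + 1
even≢oddℤ i j eq = ℕ.even≢odd ∣ i - j ∣ 0 (begin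
  2 ℕ.* ∣ i - j ∣              ≡⟨ ℤ.abs-* (+ 2) (i - j) ⟨
  ∣ + 2 * (i - j) ∣            ≡⟨ cong ∣_∣ (trans (distrib i j) (cong (_- + 2 * j) eq)) ⟩
  ∣ + 2 * j + + 1 - + 2 * j ∣  ≡⟨ cong ∣_∣ (cancel j) ⟩
  1                            ∎)
  where
  open ≡-Reasoning
  distrib : ∀ i j → + 2 * (i - j) ≡ + 2 * i - + 2 * j
  distrib = solve-∀
  cancel : ∀ j → + 2 * j + + 1 - + 2 * j ≡ + 1
  cancel = solve-∀

i≡j+[i-j] : ∀ i j → i ≡ j + (i - j)
i≡j+[i-j] = solve-∀

SameParity : ℤ → ℤ → Set
SameParity i j = ∃[ s ] i ≡ j + + 2 * s

sameParity-twoOfThree : ∀ i j k → SameParity i j ⊎ SameParity i k ⊎ SameParity j k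
sameParity-twoOfThree i j k with even⊎oddℤ (i - j) | even⊎oddℤ (i - k)
... | s , inj₁ i-j≡2s | _ = inj₁ (s , trans (i≡j+[i-j] i j) (cong (_+_ j) i-j≡2s))
... | _ , inj₂ _ | t , inj₁ i-k≡2t = inj₂ (inj₁ (t , trans (i≡j+[i-j] i k) (cong (_+_ k) i-k≡2t)))
... | s , inj₂ i-j≡2s+1 | t , inj₂ i-k≡2t+1 = inj₂ (inj₂ (t - s , (begin
  j                                        ≡⟨ telescope i j k ⟩
  k + ((i - k) - (i - j))                  ≡⟨ cong₂ (λ u v → k + (u - v)) i-k≡2t+1 i-j≡2s+1 ⟩
  k + ((+ 2 * t + + 1) - (+ 2 * s + + 1))  ≡⟨ cancel k s t ⟩
  k + + 2 * (t - s)                        ∎)))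
  where
  open ≡-Reasoning
  telescope : ∀ i j k → j ≡ k + ((i - k) - (i - j))
  telescope = solve-∀
  cancel : ∀ k s t → k + ((+ 2 * t + + 1) - (+ 2 * s + + 1)) ≡ k + + 2 * (t - s)
  cancel = solve-∀

evenSumOfSquares⇒sameParity : ∀ i j n → i * i + j * j ≡ + 2 * n → SameParity i j
evenSumOfSquares⇒sameParity i j n eq with even⊎oddℤ (i - j)
... | s , inj₁ i-j≡2s = s , trans (i≡j+[i-j] i j) (cong (_+_ j) i-j≡2s)
... | s , inj₂ i-j≡2s+1 = ⊥-elim (even≢oddℤ n (j * j + j * d + + 2 * (s * s + s)) (begin
  + 2 * n                                          ≡⟨ eq ⟨
  i * i + j * j                                    ≡⟨ expand i j ⟩
  + 2 * (j * j + j * (i - j)) + (i - j) * (i - j)  ≡⟨ cong (λ e → + 2 * (j * j + j * e) + e * e) i-j≡2s+1 ⟩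
  + 2 * (j * j + j * d) + d * d                    ≡⟨ expand-odd (j * j + j * d) s ⟩
  + 2 * (j * j + j * d + + 2 * (s * s + s)) + + 1  ∎))
  where
  open ≡-Reasoning
  d = + 2 * s + + 1
  expand : ∀ i j → i * i + j * j ≡ + 2 * (j * j + j * (i - j)) + (i - j) * (i - j)
  expand = solve-∀
  expand-odd : ∀ A s → + 2 * A + (+ 2 * s + + 1) * (+ 2 * s + + 1) ≡ + 2 * (A + + 2 * (s * s + s)) + + 1
  expand-odd = solve-∀

∣_∣² : ℤ → ℕ
∣ i ∣² = ∣ i ∣ ℕ.* ∣ i ∣

i*i≡+∣i∣² : ∀ i → i * i ≡ + ∣ i ∣²
i*i≡+∣i∣² (+ n)    = sym (ℤ.pos-* n n)
i*i≡+∣i∣² -[1+ n ] = refl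

∣i∣²≡0⇒i≡0 : ∀ i → ∣ i ∣² ≡ 0 → i ≡ + 0
∣i∣²≡0⇒i≡0 i eq with ℕ.m*n≡0⇒m≡0∨n≡0 ∣ i ∣ eq
... | inj₁ ∣i∣≡0 = ℤ.∣i∣≡0⇒i≡0 ∣i∣≡0
... | inj₂ ∣i∣≡0 = ℤ.∣i∣≡0⇒i≡0 ∣i∣≡0

squares₂≡+∣∣² : ∀ a b → a * a + b * b ≡ + (∣ a ∣² ℕ.+ ∣ b ∣²)
squares₂≡+∣∣² a b = trans (cong₂ _+_ (i*i≡+∣i∣² a) (i*i≡+∣i∣² b)) (sym (ℤ.pos-+ ∣ a ∣² ∣ b ∣²))

squares₃≡+∣∣² : ∀ a b c → a * a + b * b + c * c ≡ + (∣ a ∣² ℕ.+ ∣ b ∣² ℕ.+ ∣ c ∣²)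
squares₃≡+∣∣² a b c = trans (cong₂ _+_ (squares₂≡+∣∣² a b) (i*i≡+∣i∣² c)) (sym (ℤ.pos-+ _ ∣ c ∣²))

squares₄≡+∣∣² : ∀ a b c d →
  a * a + b * b + c * c + d * d ≡ + (∣ a ∣² ℕ.+ ∣ b ∣² ℕ.+ ∣ c ∣² ℕ.+ ∣ d ∣²)
squares₄≡+∣∣² a b c d = trans (cong₂ _+_ (squares₃≡+∣∣² a b c) (i*i≡+∣i∣² d)) (sym (ℤ.pos-+ _ ∣ d ∣²))

squares₄≡0⇒≡0 : ∀ a b c d → a * a + b * b + c * c + d * d ≡ + 0 →
                a ≡ + 0 × b ≡ + 0 × c ≡ + 0 × d ≡ + 0
squares₄≡0⇒≡0 a b c d eq =
  ∣i∣²≡0⇒i≡0 a (ℕ.m+n≡0⇒m≡0 _ ab≡0) , ∣i∣²≡0⇒i≡0 b (ℕ.m+n≡0⇒n≡0 _ ab≡0) ,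
  ∣i∣²≡0⇒i≡0 c (ℕ.m+n≡0⇒n≡0 _ abc≡0) , ∣i∣²≡0⇒i≡0 d (ℕ.m+n≡0⇒n≡0 _ abcd≡0)
  where
  abcd≡0 = ℤ.+-injective (trans (sym (squares₄≡+∣∣² a b c d)) eq)
  abc≡0 = ℕ.m+n≡0⇒m≡0 _ abcd≡0
  ab≡0 = ℕ.m+n≡0⇒m≡0 _ abc≡0

-- Halving a sum of four squares

IsSumOfFourSquares : ℤ → Set
IsSumOfFourSquares n = ∃[ a ] ∃[ b ] ∃[ c ] ∃[ d ] a * a + b * b + c * c + d * d ≡ n

[j+2s]²+j²≡2[[j+s]²+s²] : ∀ j s → (j + + 2 * s) * (j + + 2 * s) + j * j ≡ + 2 * ((j + s) * (j + s) + s * s)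
[j+2s]²+j²≡2[[j+s]²+s²] = solve-∀

squares-complement-even : ∀ a b c d n P → a * a + b * b ≡ + 2 * P →
                          a * a + b * b + c * c + d * d ≡ + 2 * n → c * c + d * d ≡ + 2 * (n - P)
squares-complement-even a b c d n P ab≡2P eq = begin
  c * c + d * d                                      ≡⟨ complement a b c d ⟩
  (a * a + b * b + c * c + d * d) - (a * a + b * b)  ≡⟨ cong₂ _-_ eq ab≡2P ⟩
  + 2 * n - + 2 * P                                  ≡⟨ distrib n P ⟩
  + 2 * (n - P)                                      ∎
  where
  open ≡-Reasoning
  complement : ∀ a b c d → c * c + d * d ≡ (a * a + b * b + c * c + d * d) - (a * a + b * b)
  complement = solve-∀
  distrib : ∀ n P → + 2 * n - + 2 * P ≡ + 2 * (n - P)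
  distrib = solve-∀

halve-sameParity : ∀ a b c d n → SameParity a b →
                   a * a + b * b + c * c + d * d ≡ + 2 * n → IsSumOfFourSquares n
halve-sameParity _ b c d n (s , refl) eq
  with t , refl ← evenSumOfSquares⇒sameParity c d _
                    (squares-complement-even (b + + 2 * s) b c d n _ ([j+2s]²+j²≡2[[j+s]²+s²] b s) eq)
  = b + s , s , d + t , t , ℤ.*-cancelˡ-≡ (+ 2) _ n (trans (halves b s d t) eq)
  where
  halves : ∀ b s d t → + 2 * ((b + s) * (b + s) + s * s + (d + t) * (d + t) + t * t)
    ≡ (b + + 2 * s) * (b + + 2 * s) + b * b + (d + + 2 * t) * (d + + 2 * t) + d * d
  halves = solve-∀

isSumOfFourSquares-half : ∀ n → IsSumOfFourSquares (+ 2 * n) → IsSumOfFourSquares n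
isSumOfFourSquares-half n (a , b , c , d , eq) with sameParity-twoOfThree a b c
... | inj₁ ab        = halve-sameParity a b c d n ab eq
... | inj₂ (inj₁ ac) = halve-sameParity a c b d n ac (trans (reorder a b c d) eq)
  where reorder : ∀ a b c d → a * a + c * c + b * b + d * d ≡ a * a + b * b + c * c + d * d
        reorder = solve-∀
... | inj₂ (inj₂ bc) = halve-sameParity b c a d n bc (trans (reorder a b c d) eq)
  where reorder : ∀ a b c d → b * b + c * c + a * a + d * d ≡ a * a + b * b + c * c + d * d
        reorder = solve-∀

-- Descent by an odd multiplier

∣+m-+n∣≤n : ∀ {m n} → m ℕ.≤ 2 ℕ.* n → ∣ + m - + n ∣ ℕ.≤ n
∣+m-+n∣≤n {m} {n} m≤2n rewrite ℤ.[+m]-[+n]≡m⊖n m n with ℕ.≤-total m n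
... | inj₁ m≤n rewrite ℤ.∣⊖∣-≤ m≤n = ℕ.m∸n≤m n m
... | inj₂ n≤m rewrite ℤ.∣m⊖n∣≡∣n⊖m∣ m n | ℤ.∣⊖∣-≤ n≤m =
  ℕ.m≤n+o⇒m∸n≤o m n (subst (m ℕ.≤_) (2*n≡n+n n) m≤2n)

centredResidue : ∀ g i → ∃[ r ] ∃[ q ] i ≡ r + + suc (2 ℕ.* g) * q × ∣ r ∣ ℕ.≤ g
centredResidue g i =
  + (t %ℕ M) - + g , t /ℕ M ,
  trans (shift i (+ g)) (trans (cong (_- + g) (a≡a%ℕn+[a/ℕn]*n t M)) (regroup (+ (t %ℕ M)) (t /ℕ M) (+ M) (+ g))) ,
  ∣+m-+n∣≤n (ℕ.≤-pred (n%ℕd<d t M))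
  where
  M = suc (2 ℕ.* g)
  t = i + + g
  shift : ∀ i g → i ≡ (i + g) - g
  shift = solve-∀
  regroup : ∀ r q M g → (r + q * M) - g ≡ (r - g) + M * q
  regroup = solve-∀

∣∣²-sum<[1+2g]² : ∀ g a b c d → ∣ a ∣ ℕ.≤ g → ∣ b ∣ ℕ.≤ g → ∣ c ∣ ℕ.≤ g → ∣ d ∣ ℕ.≤ g →
                  ∣ a ∣² ℕ.+ ∣ b ∣² ℕ.+ ∣ c ∣² ℕ.+ ∣ d ∣² < suc (2 ℕ.* g) ℕ.* suc (2 ℕ.* g)
∣∣²-sum<[1+2g]² g _ _ _ _ a≤g b≤g c≤g d≤g = begin-strict
  _                                              ≤⟨ ℕ.+-mono-≤ (ℕ.+-mono-≤ (ℕ.+-mono-≤ (square-mono a≤g) (square-mono b≤g))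
                                                                           (square-mono c≤g)) (square-mono d≤g) ⟩
  g ℕ.* g ℕ.+ g ℕ.* g ℕ.+ g ℕ.* g ℕ.+ g ℕ.* g   <⟨ s≤s (ℕ.m≤m+n _ (4 ℕ.* g)) ⟩
  suc (g ℕ.* g ℕ.+ g ℕ.* g ℕ.+ g ℕ.* g ℕ.+ g ℕ.* g ℕ.+ 4 ℕ.* g) ≡⟨ expand g ⟩
  suc (2 ℕ.* g) ℕ.* suc (2 ℕ.* g)                ∎
  where
  open ℕ.≤-Reasoning
  square-mono : ∀ {m} → m ℕ.≤ g → m ℕ.* m ℕ.≤ g ℕ.* g
  square-mono m≤g = ℕ.*-mono-≤ m≤g m≤g
  expand : ∀ g → suc (g ℕ.* g ℕ.+ g ℕ.* g ℕ.+ g ℕ.* g ℕ.+ g ℕ.* g ℕ.+ 4 ℕ.* g) ≡ suc (2 ℕ.* g) ℕ.* suc (2 ℕ.* g)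
  expand = ℕ-Ring.solve-∀

squares-shifted : ∀ m a b c d x y z w → a * a + b * b + c * c + d * d ≡
  ((a + m * x) * (a + m * x) + (b + m * y) * (b + m * y) + (c + m * z) * (c + m * z) + (d + m * w) * (d + m * w))
  - m * (x * (+ 2 * a + m * x) + y * (+ 2 * b + m * y) + z * (+ 2 * c + m * z) + w * (+ 2 * d + m * w))
squares-shifted = solve-∀

euler-four-squares-shifted : ∀ m a b c d x y z w →
  ((a + m * x) * (a + m * x) + (b + m * y) * (b + m * y) + (c + m * z) * (c + m * z) + (d + m * w) * (d + m * w))
    * (a * a + b * b + c * c + d * d)
  ≡ (a * a + b * b + c * c + d * d + m * (x * a + y * b + z * c + w * d))
      * (a * a + b * b + c * c + d * d + m * (x * a + y * b + z * c + w * d))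
    + (m * (x * b - y * a + z * d - w * c)) * (m * (x * b - y * a + z * d - w * c))
    + (m * (x * c - z * a + w * b - y * d)) * (m * (x * c - z * a + w * b - y * d))
    + (m * (x * d - w * a + y * c - z * b)) * (m * (x * d - w * a + y * c - z * b))
euler-four-squares-shifted = solve-∀

isSumOfFourSquares-quotient : ∀ m a b c d x y z w P R .{{_ : NonZero m}} →
  (a + m * x) * (a + m * x) + (b + m * y) * (b + m * y) + (c + m * z) * (c + m * z) + (d + m * w) * (d + m * w)
    ≡ m * P →
  a * a + b * b + c * c + d * d ≡ m * R →
  IsSumOfFourSquares (R * P)
isSumOfFourSquares-quotient m a b c d x y z w P R eqP eqR =
  R + L , T₂ , T₃ , T₄ , ℤ.*-cancelˡ-≡ m _ _ (ℤ.*-cancelˡ-≡ m _ _ (begin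
    m * (m * ((R + L) * (R + L) + T₂ * T₂ + T₃ * T₃ + T₄ * T₄))
      ≡⟨ distrib m R L T₂ T₃ T₄ ⟩
    (m * R + m * L) * (m * R + m * L) + (m * T₂) * (m * T₂) + (m * T₃) * (m * T₃) + (m * T₄) * (m * T₄)
      ≡⟨ cong (λ e → (e + m * L) * (e + m * L) + (m * T₂) * (m * T₂) + (m * T₃) * (m * T₃) + (m * T₄) * (m * T₄)) eqR ⟨
    (S + m * L) * (S + m * L) + (m * T₂) * (m * T₂) + (m * T₃) * (m * T₃) + (m * T₄) * (m * T₄)
      ≡⟨ euler-four-squares-shifted m a b c d x y z w ⟨
    Sₘ * S
      ≡⟨ cong₂ _*_ eqP eqR ⟩
    (m * P) * (m * R)
      ≡⟨ regroup m P R ⟩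
    m * (m * (R * P)) ∎))
  where
  open ≡-Reasoning
  S = a * a + b * b + c * c + d * d
  Sₘ = (a + m * x) * (a + m * x) + (b + m * y) * (b + m * y) + (c + m * z) * (c + m * z) + (d + m * w) * (d + m * w)
  L = x * a + y * b + z * c + w * d
  T₂ = x * b - y * a + z * d - w * c
  T₃ = x * c - z * a + w * b - y * d
  T₄ = x * d - w * a + y * c - z * b
  distrib : ∀ m R L T₂ T₃ T₄ → m * (m * ((R + L) * (R + L) + T₂ * T₂ + T₃ * T₃ + T₄ * T₄))
    ≡ (m * R + m * L) * (m * R + m * L) + (m * T₂) * (m * T₂) + (m * T₃) * (m * T₃) + (m * T₄) * (m * T₄)
  distrib = solve-∀
  regroup : ∀ m P R → (m * P) * (m * R) ≡ m * (m * (R * P))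
  regroup = solve-∀

-- With entries reduced into [-g, g] modulo M = 2g + 1, the sum of squares is M r with
-- r < M, and r = 0 would make M divide p; dividing Euler's identity by M² then writes
-- r p as a sum of four squares.
descent-step-odd : ∀ {p} g → Prime p → 0 < g → suc (2 ℕ.* g) < p →
  IsSumOfFourSquares (+ suc (2 ℕ.* g) * + p) →
  ∃[ r ] 0 < r × r < suc (2 ℕ.* g) × IsSumOfFourSquares (+ r * + p)
descent-step-odd {p} g p-prime g>0 M<p (a₀ , b₀ , c₀ , d₀ , eq)
  with centredResidue g a₀ | centredResidue g b₀ | centredResidue g c₀ | centredResidue g d₀
... | a , x , refl , a≤g | b , y , refl , b≤g | c , z , refl , c≤g | d , w , refl , d≤g
  = quotient (+ p - Q) (trans (squares-shifted (+ M) a b c d x y z w)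
                              (trans (cong (_- + M * Q) eq) (factor-out (+ M) (+ p) Q)))
  where
  M = suc (2 ℕ.* g)
  S = a * a + b * b + c * c + d * d
  Q = x * (+ 2 * a + + M * x) + y * (+ 2 * b + + M * y) + z * (+ 2 * c + + M * z) + w * (+ 2 * d + + M * w)

  factor-out : ∀ m P Q → m * P - m * Q ≡ m * (P - Q)
  factor-out = solve-∀

  instance
    M-nonTrivial : ℕ.NonTrivial M
    M-nonTrivial = ℕ.n>1⇒nonTrivial (s≤s (ℕ.≤-trans g>0 (ℕ.m≤m+n g _)))

  not-all-zero : a ≡ + 0 × b ≡ + 0 × c ≡ + 0 × d ≡ + 0 → ⊥
  not-all-zero (refl , refl , refl , refl) =
    prime⇒¬composite p-prime (composite M<p (divides ∣ X ∣ (begin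
      p             ≡⟨ cong ∣_∣ (ℤ.*-cancelˡ-≡ (+ M) (+ M * X) (+ p) (trans (sym (scaled x y z w (+ M))) eq)) ⟨
      ∣ + M * X ∣   ≡⟨ ℤ.abs-* (+ M) X ⟩
      M ℕ.* ∣ X ∣   ≡⟨ ℕ.*-comm M ∣ X ∣ ⟩
      ∣ X ∣ ℕ.* M   ∎)))
    where
    open ≡-Reasoning
    X = x * x + y * y + z * z + w * w
    scaled : ∀ x y z w m → (+ 0 + m * x) * (+ 0 + m * x) + (+ 0 + m * y) * (+ 0 + m * y)
      + (+ 0 + m * z) * (+ 0 + m * z) + (+ 0 + m * w) * (+ 0 + m * w) ≡ m * (m * (x * x + y * y + z * z + w * w))
    scaled = solve-∀

  quotient : ∀ R → S ≡ + M * R → ∃[ r ] 0 < r × r < M × IsSumOfFourSquares (+ r * + p)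
  quotient -[1+ _ ] S≡MR with trans (sym (squares₄≡+∣∣² a b c d)) S≡MR
  ... | ()
  quotient (+ 0) S≡MR = ⊥-elim (not-all-zero (squares₄≡0⇒≡0 a b c d (trans S≡MR (ℤ.*-zeroʳ (+ M)))))
  quotient (+ suc r) S≡MR =
    suc r , s≤s z≤n , ℕ.*-cancelˡ-< M (suc r) M (begin-strict
      M ℕ.* suc r
        ≡⟨ ℤ.+-injective (trans (ℤ.pos-* M (suc r)) (trans (sym S≡MR) (squares₄≡+∣∣² a b c d))) ⟩
      ∣ a ∣² ℕ.+ ∣ b ∣² ℕ.+ ∣ c ∣² ℕ.+ ∣ d ∣²
        <⟨ ∣∣²-sum<[1+2g]² g a b c d a≤g b≤g c≤g d≤g ⟩
      M ℕ.* M ∎) ,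
    isSumOfFourSquares-quotient (+ M) a b c d x y z w (+ p) (+ suc r) eq S≡MR
    where open ℕ.≤-Reasoning

descent : ∀ {p} → Prime p → ∀ m → 0 < m → m < p →
          IsSumOfFourSquares (+ m * + p) → IsSumOfFourSquares (+ p)
descent {p} p-prime = <-rec _ step
  where
  step : ∀ m → (∀ {k} → k < m → 0 < k → k < p → IsSumOfFourSquares (+ k * + p) → IsSumOfFourSquares (+ p)) →
         0 < m → m < p → IsSumOfFourSquares (+ m * + p) → IsSumOfFourSquares (+ p)
  step m rec 0<m m<p mp≡□ with even⊎oddℕ m
  ... | zero  , inj₁ refl = ⊥-elim (ℕ.<-irrefl refl 0<m)
  ... | suc k , inj₁ refl = rec k<m (s≤s z≤n) (ℕ.<-trans k<m m<p)
    (isSumOfFourSquares-half (+ suc k * + p) (subst IsSumOfFourSquares (+[2k]*p≡2*[k*p] (suc k)) mp≡□))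
    where
    k<m : suc k < 2 ℕ.* suc k
    k<m = ℕ.m<m+n (suc k) (s≤s z≤n)
    +[2k]*p≡2*[k*p] : ∀ k → + (2 ℕ.* k) * + p ≡ + 2 * (+ k * + p)
    +[2k]*p≡2*[k*p] k = trans (cong (_* + p) (ℤ.pos-* 2 k)) (ℤ.*-assoc (+ 2) (+ k) (+ p))
  ... | zero  , inj₂ refl = subst IsSumOfFourSquares (ℤ.*-identityˡ (+ p)) mp≡□
  ... | suc g , inj₂ refl with descent-step-odd (suc g) p-prime (s≤s z≤n) m<p mp≡□
  ...   | r , 0<r , r<m , rp≡□ = rec r<m 0<r (ℕ.<-trans r<m m<p) rp≡□

-- A small multiple of an odd prime is a sum of four squares

m%p≡[m+k]%p⇒p∣k : ∀ m k p .{{_ : ℕ.NonZero p}} → m % p ≡ (m ℕ.+ k) % p → p ∣ k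
m%p≡[m+k]%p⇒p∣k m k p eq = ∣m+n∣m⇒∣n (divides ((m ℕ.+ k) / p) (ℕ.+-cancelˡ-≡ (m % p) _ _ (begin
  m % p ℕ.+ (m / p ℕ.* p ℕ.+ k)          ≡⟨ ℕ.+-assoc (m % p) _ k ⟨
  m % p ℕ.+ m / p ℕ.* p ℕ.+ k            ≡⟨ cong (ℕ._+ k) (m≡m%n+[m/n]*n m p) ⟨
  m ℕ.+ k                                ≡⟨ m≡m%n+[m/n]*n (m ℕ.+ k) p ⟩
  (m ℕ.+ k) % p ℕ.+ (m ℕ.+ k) / p ℕ.* p  ≡⟨ cong (ℕ._+ (m ℕ.+ k) / p ℕ.* p) eq ⟨
  m % p ℕ.+ (m ℕ.+ k) / p ℕ.* p          ∎)))
  (n∣m*n (m / p))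
  where open ≡-Reasoning

m%p≡p∸1+n%p⇒p∣m+n+1 : ∀ m n p .{{_ : ℕ.NonZero p}} → m % p ≡ p ∸ suc (n % p) → p ∣ m ℕ.+ n ℕ.+ 1
m%p≡p∸1+n%p⇒p∣m+n+1 m n p eq = divides (suc (m / p ℕ.+ n / p)) (begin
  m ℕ.+ n ℕ.+ 1
    ≡⟨ cong₂ (λ u v → u ℕ.+ v ℕ.+ 1) (m≡m%n+[m/n]*n m p) (m≡m%n+[m/n]*n n p) ⟩
  (m % p ℕ.+ m / p ℕ.* p) ℕ.+ (n % p ℕ.+ n / p ℕ.* p) ℕ.+ 1
    ≡⟨ regroup (m % p) (n % p) (m / p) (n / p) p ⟩
  (m % p ℕ.+ suc (n % p)) ℕ.+ (m / p ℕ.+ n / p) ℕ.* p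
    ≡⟨ cong (λ u → u ℕ.+ suc (n % p) ℕ.+ (m / p ℕ.+ n / p) ℕ.* p) eq ⟩
  (p ∸ suc (n % p) ℕ.+ suc (n % p)) ℕ.+ (m / p ℕ.+ n / p) ℕ.* p
    ≡⟨ cong (ℕ._+ (m / p ℕ.+ n / p) ℕ.* p) (ℕ.m∸n+n≡m (m%n<n n p)) ⟩
  suc (m / p ℕ.+ n / p) ℕ.* p ∎)
  where
  open ≡-Reasoning
  regroup : ∀ r s q t p → (r ℕ.+ q ℕ.* p) ℕ.+ (s ℕ.+ t ℕ.* p) ℕ.+ 1 ≡ (r ℕ.+ suc s) ℕ.+ (q ℕ.+ t) ℕ.* p
  regroup = ℕ-Ring.solve-∀

squares-distinct-mod : ∀ {p x y} .{{_ : ℕ.NonZero p}} → Prime p → x < y → x ℕ.+ y < p →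
                       (x ℕ.* x) % p ≢ (y ℕ.* y) % p
squares-distinct-mod {p} {x} p-prime x<y x+y<p eq
  with o , refl ← ℕ.m≤n⇒∃[o]m+o≡n x<y
  with euclidsLemma (suc o) (x ℕ.+ suc (x ℕ.+ o)) p-prime
         (m%p≡[m+k]%p⇒p∣k (x ℕ.* x) _ p (trans eq (cong (_% p) (difference-of-squares x o))))
  where
  difference-of-squares : ∀ x o → suc (x ℕ.+ o) ℕ.* suc (x ℕ.+ o) ≡ x ℕ.* x ℕ.+ suc o ℕ.* (x ℕ.+ suc (x ℕ.+ o))
  difference-of-squares = ℕ-Ring.solve-∀
... | inj₁ p∣y-x = ℕ.<-irrefl refl (ℕ.≤-<-trans (∣⇒≤ p∣y-x)
                     (ℕ.≤-<-trans (ℕ.≤-trans (s≤s (ℕ.m≤n+m o x)) (ℕ.m≤n+m _ x)) x+y<p))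
... | inj₂ p∣x+y = ℕ.<-irrefl refl (ℕ.≤-<-trans (∣⇒≤ {{x+y≢0}} p∣x+y) x+y<p)
  where x+y≢0 = ℕ.>-nonZero (ℕ.<-≤-trans (s≤s z≤n) (ℕ.m≤n+m (suc (x ℕ.+ o)) x))

-- Pigeonhole on the p + 1 residues of x² and of −1 − y² for 0 ≤ x, y ≤ h: two squares
-- in this range are never congruent, so some x² ≡ −1 − y² (mod p).
x²+y²+1≡0-modPrime : ∀ h → Prime (suc (2 ℕ.* h)) →
  ∃[ x ] ∃[ y ] x ℕ.≤ h × y ℕ.≤ h × suc (2 ℕ.* h) ∣ x ℕ.* x ℕ.+ y ℕ.* y ℕ.+ 1
x²+y²+1≡0-modPrime h p-prime = solution
  where
  p = suc (2 ℕ.* h)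

  x+y<p : ∀ {x y} → x ℕ.≤ h → y ℕ.≤ h → x ℕ.+ y < p
  x+y<p {x} {y} x≤h y≤h = s≤s (subst (x ℕ.+ y ℕ.≤_) (sym (2*n≡n+n h)) (ℕ.+-mono-≤ x≤h y≤h))

  l∸[1+h]≤h : ∀ {l} → l ℕ.≤ p → l ∸ suc h ℕ.≤ h
  l∸[1+h]≤h {l} l≤p = ℕ.m≤n+o⇒m∸n≤o l (suc h) (subst (l ℕ.≤_) (cong suc (2*n≡n+n h)) l≤p)

  -- p ∸ suc r is the residue of −1 − r for r < p
  residue : ℕ → ℕ
  residue k with k ℕ.≤? h
  ... | yes _ = (k ℕ.* k) % p
  ... | no  _ = p ∸ suc (((k ∸ suc h) ℕ.* (k ∸ suc h)) % p)

  residue<p : ∀ k → residue k < p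
  residue<p k with k ℕ.≤? h
  ... | yes _ = m%n<n (k ℕ.* k) p
  ... | no  _ = s≤s (ℕ.m∸n≤m (2 ℕ.* h) (((k ∸ suc h) ℕ.* (k ∸ suc h)) % p))

  Solution = ∃[ x ] ∃[ y ] x ℕ.≤ h × y ℕ.≤ h × p ∣ x ℕ.* x ℕ.+ y ℕ.* y ℕ.+ 1

  collision : ∀ k l → k < l → l ℕ.≤ p → residue k ≡ residue l → Solution
  collision k l k<l l≤p eq with k ℕ.≤? h | l ℕ.≤? h
  ... | yes k≤h | yes l≤h = ⊥-elim (squares-distinct-mod p-prime k<l (x+y<p k≤h l≤h) eq)
  ... | yes k≤h | no  _   =
    k , l ∸ suc h , k≤h , l∸[1+h]≤h l≤p , m%p≡p∸1+n%p⇒p∣m+n+1 (k ℕ.* k) ((l ∸ suc h) ℕ.* (l ∸ suc h)) p eq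
  ... | no  k≰h | yes l≤h = ⊥-elim (k≰h (ℕ.≤-trans (ℕ.<⇒≤ k<l) l≤h))
  ... | no  k≰h | no  _   = ⊥-elim (squares-distinct-mod p-prime
        (ℕ.∸-monoˡ-< k<l (ℕ.≰⇒> k≰h)) (x+y<p (l∸[1+h]≤h (ℕ.≤-trans (ℕ.<⇒≤ k<l) l≤p)) (l∸[1+h]≤h l≤p))
        (ℕ.suc-injective (ℕ.∸-cancelˡ-≡ (m%n<n ((k ∸ suc h) ℕ.* (k ∸ suc h)) p)
                                         (m%n<n ((l ∸ suc h) ℕ.* (l ∸ suc h)) p) eq)))

  solution : Solution
  solution with pigeonhole (ℕ.n<1+n p) (λ i → fromℕ< (residue<p (toℕ i)))
  ... | i , j , i<j , eq = collision (toℕ i) (toℕ j) i<j (ℕ.≤-pred (toℕ<n j))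
    (trans (sym (toℕ-fromℕ< (residue<p (toℕ i)))) (trans (cong toℕ eq) (toℕ-fromℕ< (residue<p (toℕ j)))))

prime[1+2h]⇒h>0 : ∀ h → Prime (suc (2 ℕ.* h)) → 0 < h
prime[1+2h]⇒h>0 zero    p-prime = ⊥-elim (ℕ.nonTrivial⇒≢1 {{prime⇒nonTrivial p-prime}} refl)
prime[1+2h]⇒h>0 (suc _) _       = s≤s z≤n

isSumOfFourSquares-smallMultiple : ∀ h → Prime (suc (2 ℕ.* h)) →
  ∃[ m ] 0 < m × m < suc (2 ℕ.* h) × IsSumOfFourSquares (+ m * + suc (2 ℕ.* h))
isSumOfFourSquares-smallMultiple h p-prime with x²+y²+1≡0-modPrime h p-prime
... | x , y , x≤h , y≤h , divides zero    eq = ⊥-elim (ℕ.1+n≢0 (ℕ.m+n≡0⇒n≡0 _ eq))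
... | x , y , x≤h , y≤h , divides (suc m) eq = suc m , s≤s z≤n , m<p , + x , + y , + 1 , + 0 , sum≡
  where
  p = suc (2 ℕ.* h)

  sum≡ : + x * + x + + y * + y + + 1 * + 1 + + 0 * + 0 ≡ + suc m * + p
  sum≡ = begin
    + x * + x + + y * + y + + 1 * + 1 + + 0 * + 0  ≡⟨ squares₄≡+∣∣² (+ x) (+ y) (+ 1) (+ 0) ⟩
    + (x ℕ.* x ℕ.+ y ℕ.* y ℕ.+ 1 ℕ.+ 0)           ≡⟨ cong +_ (trans (ℕ.+-identityʳ _) eq) ⟩
    + (suc m ℕ.* p)                               ≡⟨ ℤ.pos-* (suc m) p ⟩
    + suc m * + p                                 ∎
    where open ≡-Reasoning

  m<p : suc m < p
  m<p = ℕ.*-cancelʳ-< p (suc m) p (begin-strict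
    suc m ℕ.* p                                              ≡⟨ eq ⟨
    x ℕ.* x ℕ.+ y ℕ.* y ℕ.+ 1                                ≤⟨ ℕ.+-monoˡ-≤ 1 (ℕ.+-mono-≤ (ℕ.*-mono-≤ x≤h x≤h)
                                                                                          (ℕ.*-mono-≤ y≤h y≤h)) ⟩
    h ℕ.* h ℕ.+ h ℕ.* h ℕ.+ 1                                <⟨ ℕ.m<m+n _ 0<rest ⟩
    h ℕ.* h ℕ.+ h ℕ.* h ℕ.+ 1 ℕ.+ (h ℕ.* h ℕ.+ h ℕ.* h ℕ.+ 4 ℕ.* h) ≡⟨ expand h ⟩
    p ℕ.* p                                                  ∎)
    where
    open ℕ.≤-Reasoning
    0<rest : 0 < h ℕ.* h ℕ.+ h ℕ.* h ℕ.+ 4 ℕ.* h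
    0<rest = ℕ.<-≤-trans (ℕ.*-monoʳ-< 4 (prime[1+2h]⇒h>0 h p-prime)) (ℕ.m≤n+m (4 ℕ.* h) (h ℕ.* h ℕ.+ h ℕ.* h))
    expand : ∀ h → h ℕ.* h ℕ.+ h ℕ.* h ℕ.+ 1 ℕ.+ (h ℕ.* h ℕ.+ h ℕ.* h ℕ.+ 4 ℕ.* h) ≡ suc (2 ℕ.* h) ℕ.* suc (2 ℕ.* h)
    expand = ℕ-Ring.solve-∀

isSumOfFourSquares-oddPrime : ∀ h → Prime (suc (2 ℕ.* h)) → IsSumOfFourSquares (+ suc (2 ℕ.* h))
isSumOfFourSquares-oddPrime h p-prime with isSumOfFourSquares-smallMultiple h p-prime
... | m , 0<m , m<p , mp≡□ = descent p-prime m 0<m m<p mp≡□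

-- Three squares

prime≢square : ∀ {p} k → Prime p → k ℕ.* k ≢ p
prime≢square {p} k p-prime k*k≡p with prime⇒irreducible p-prime (divides k (sym k*k≡p))
... | inj₁ refl = ℕ.nonTrivial⇒≢1 {{prime⇒nonTrivial p-prime}} (sym k*k≡p)
... | inj₂ refl = ℕ.nonTrivial⇒≢1 {{prime⇒nonTrivial p-prime}}
    (ℕ.*-cancelˡ-≡ k 1 k {{ℕ.nonTrivial⇒nonZero k {{prime⇒nonTrivial p-prime}}}} (trans k*k≡p (sym (ℕ.*-identityʳ k))))

twoSquares≡prime⇒>0 : ∀ {p} c d → Prime p → ∣ c ∣² ℕ.+ ∣ d ∣² ≡ p → 0 < ∣ c ∣² × 0 < ∣ d ∣²
twoSquares≡prime⇒>0 {p} c d p-prime eq =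
  ℕ.n≢0⇒n>0 (λ c²≡0 → prime≢square ∣ d ∣ p-prime (subst (λ t → t ℕ.+ ∣ d ∣² ≡ p) c²≡0 eq)) ,
  ℕ.n≢0⇒n>0 (λ d²≡0 → prime≢square ∣ c ∣ p-prime
    (trans (sym (ℕ.+-identityʳ ∣ c ∣²)) (subst (λ t → ∣ c ∣² ℕ.+ t ≡ p) d²≡0 eq)))

squares₄-pair≡0 : ∀ a b c d {n} → a * a + b * b + c * c + d * d ≡ + n →
                  ∣ a ∣² ℕ.+ ∣ b ∣² ≡ 0 → ∣ c ∣² ℕ.+ ∣ d ∣² ≡ n
squares₄-pair≡0 a b c d {n} eq ab≡0 =
  subst (λ t → t ℕ.+ ∣ c ∣² ℕ.+ ∣ d ∣² ≡ n) ab≡0 (ℤ.+-injective (trans (sym (squares₄≡+∣∣² a b c d)) eq))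

FourSquaresWithPositivePairs : ℕ → Set
FourSquaresWithPositivePairs n = ∃[ a ] ∃[ b ] ∃[ c ] ∃[ d ]
  (a * a + b * b + c * c + d * d ≡ + n × 0 < ∣ a ∣² ℕ.+ ∣ b ∣² × 0 < ∣ c ∣² ℕ.+ ∣ d ∣²)

prime-fourSquares-pairsPositive : ∀ {p} → Prime p → IsSumOfFourSquares (+ p) → FourSquaresWithPositivePairs p
prime-fourSquares-pairsPositive p-prime (a , b , c , d , eq)
  with ∣ a ∣² ℕ.+ ∣ b ∣² ℕ.≟ 0 | ∣ c ∣² ℕ.+ ∣ d ∣² ℕ.≟ 0
... | no ab≢0 | no cd≢0 = a , b , c , d , eq , ℕ.n≢0⇒n>0 ab≢0 , ℕ.n≢0⇒n>0 cd≢0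
... | yes ab≡0 | _ =
  let c>0 , d>0 = twoSquares≡prime⇒>0 c d p-prime (squares₄-pair≡0 a b c d eq ab≡0)
  in c , a , d , b , trans (reorder a b c d) eq , ℕ.≤-trans c>0 (ℕ.m≤m+n _ _) , ℕ.≤-trans d>0 (ℕ.m≤m+n _ _)
  where
  reorder : ∀ a b c d → c * c + a * a + d * d + b * b ≡ a * a + b * b + c * c + d * d
  reorder = solve-∀
... | no _ | yes cd≡0 =
  let a>0 , b>0 = twoSquares≡prime⇒>0 a b p-prime (squares₄-pair≡0 c d a b (trans (swap a b c d) eq) cd≡0)
  in a , c , b , d , trans (reorder a b c d) eq , ℕ.≤-trans a>0 (ℕ.m≤m+n _ _) , ℕ.≤-trans b>0 (ℕ.m≤m+n _ _)
  where
  swap : ∀ a b c d → c * c + d * d + a * a + b * b ≡ a * a + b * b + c * c + d * d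
  swap = solve-∀
  reorder : ∀ a b c d → a * a + c * c + b * b + d * d ≡ a * a + b * b + c * c + d * d
  reorder = solve-∀

SquareIsSumOfThreeSmallerSquares : ℕ → Set
SquareIsSumOfThreeSmallerSquares n =
  ∃[ x ] ∃[ y ] ∃[ z ] (∣ x ∣ < n × ∣ y ∣ < n × ∣ z ∣ < n × x * x + y * y + z * z ≡ + n * + n)

m*m+k≡n*n⇒m<n : ∀ {m k n} → m ℕ.* m ℕ.+ k ≡ n ℕ.* n → 0 < k → m < n
m*m+k≡n*n⇒m<n {m} {k} {n} eq 0<k with n ℕ.≤? m
... | no  n≰m = ℕ.≰⇒> n≰m
... | yes n≤m = ⊥-elim (ℕ.<-irrefl (sym eq) (ℕ.≤-<-trans (ℕ.*-mono-≤ n≤m n≤m) (ℕ.m<m+n (m ℕ.* m) 0<k)))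

four-squares-squared : ∀ a b c d →
  (a * a + b * b - c * c - d * d) * (a * a + b * b - c * c - d * d)
  + (+ 2 * (a * d + b * c)) * (+ 2 * (a * d + b * c))
  + (+ 2 * (b * d - a * c)) * (+ 2 * (b * d - a * c))
  ≡ (a * a + b * b + c * c + d * d) * (a * a + b * b + c * c + d * d)
four-squares-squared = solve-∀

squareIsSumOfThreeSmallerSquares-odd : ∀ h → FourSquaresWithPositivePairs (suc (2 ℕ.* h)) →
                                       SquareIsSumOfThreeSmallerSquares (suc (2 ℕ.* h))
squareIsSumOfThreeSmallerSquares-odd h (a , b , c , d , eq , ab>0 , cd>0) =
  X , Y , Z ,
  m*m+k≡n*n⇒m<n (trans (sym (ℕ.+-assoc ∣ X ∣² _ _)) XYZ≡N²) YZ>0 ,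
  m*m+k≡n*n⇒m<n (trans (rotate ∣ X ∣² ∣ Y ∣² ∣ Z ∣²) XYZ≡N²) (ℕ.≤-trans X>0 (ℕ.m≤m+n ∣ X ∣² ∣ Z ∣²)) ,
  m*m+k≡n*n⇒m<n (trans (rotate′ ∣ X ∣² ∣ Y ∣² ∣ Z ∣²) XYZ≡N²) (ℕ.≤-trans X>0 (ℕ.m≤m+n ∣ X ∣² ∣ Y ∣²)) ,
  sum≡N²
  where
  N = suc (2 ℕ.* h)
  X = a * a + b * b - c * c - d * d
  Y = + 2 * (a * d + b * c)
  Z = + 2 * (b * d - a * c)

  sum≡N² : X * X + Y * Y + Z * Z ≡ + N * + N
  sum≡N² = trans (four-squares-squared a b c d) (cong₂ _*_ eq eq)

  XYZ≡N² : ∣ X ∣² ℕ.+ ∣ Y ∣² ℕ.+ ∣ Z ∣² ≡ N ℕ.* N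
  XYZ≡N² = ℤ.+-injective (trans (sym (squares₃≡+∣∣² X Y Z)) (trans sum≡N² (sym (ℤ.pos-* N N))))

  YZ>0 : 0 < ∣ Y ∣² ℕ.+ ∣ Z ∣²
  YZ>0 = subst (0 <_) YZ≡4AB (ℕ.*-mono-≤ {1} {4} (s≤s z≤n) (ℕ.*-mono-≤ ab>0 cd>0))
    where
    open ≡-Reasoning
    A = ∣ a ∣² ℕ.+ ∣ b ∣²
    B = ∣ c ∣² ℕ.+ ∣ d ∣²
    two-squares-product : ∀ a b c d →
      (+ 2 * (a * d + b * c)) * (+ 2 * (a * d + b * c)) + (+ 2 * (b * d - a * c)) * (+ 2 * (b * d - a * c))
      ≡ + 4 * ((a * a + b * b) * (c * c + d * d))
    two-squares-product = solve-∀
    YZ≡4AB : 4 ℕ.* (A ℕ.* B) ≡ ∣ Y ∣² ℕ.+ ∣ Z ∣²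
    YZ≡4AB = ℤ.+-injective (begin
      + (4 ℕ.* (A ℕ.* B))                        ≡⟨ ℤ.pos-* 4 (A ℕ.* B) ⟩
      + 4 * + (A ℕ.* B)                          ≡⟨ cong (+ 4 *_) (ℤ.pos-* A B) ⟩
      + 4 * (+ A * + B)                          ≡⟨ cong₂ (λ u v → + 4 * (u * v)) (squares₂≡+∣∣² a b) (squares₂≡+∣∣² c d) ⟨
      + 4 * ((a * a + b * b) * (c * c + d * d))  ≡⟨ two-squares-product a b c d ⟨
      Y * Y + Z * Z                              ≡⟨ squares₂≡+∣∣² Y Z ⟩
      + (∣ Y ∣² ℕ.+ ∣ Z ∣²)                      ∎)

  X≢0 : X ≢ + 0
  X≢0 X≡0 = even≢oddℤ (c * c + d * d) (+ h) (begin
    + 2 * (c * c + d * d)              ≡⟨ ℤ.+-identityˡ _ ⟨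
    + 0 + + 2 * (c * c + d * d)        ≡⟨ cong (_+ + 2 * (c * c + d * d)) X≡0 ⟨
    X + + 2 * (c * c + d * d)          ≡⟨ add-back a b c d ⟩
    a * a + b * b + c * c + d * d      ≡⟨ eq ⟩
    + suc (2 ℕ.* h)                    ≡⟨ cong +_ (ℕ.+-comm 1 (2 ℕ.* h)) ⟩
    + (2 ℕ.* h ℕ.+ 1)                  ≡⟨ ℤ.pos-+ (2 ℕ.* h) 1 ⟩
    + (2 ℕ.* h) + + 1                  ≡⟨ cong (_+ + 1) (ℤ.pos-* 2 h) ⟩
    + 2 * + h + + 1                    ∎)
    where
    open ≡-Reasoning
    add-back : ∀ a b c d → (a * a + b * b - c * c - d * d) + + 2 * (c * c + d * d) ≡ a * a + b * b + c * c + d * d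
    add-back = solve-∀

  X>0 : 0 < ∣ X ∣²
  X>0 = ℕ.n≢0⇒n>0 (λ X²≡0 → X≢0 (∣i∣²≡0⇒i≡0 X X²≡0))

  rotate : ∀ x y z → y ℕ.+ (x ℕ.+ z) ≡ x ℕ.+ y ℕ.+ z
  rotate = ℕ-Ring.solve-∀
  rotate′ : ∀ x y z → z ℕ.+ (x ℕ.+ y) ≡ x ℕ.+ y ℕ.+ z
  rotate′ = ℕ-Ring.solve-∀

squareIsSumOfThreeSmallerSquares-oddPrime : ∀ h → Prime (suc (2 ℕ.* h)) →
                                            SquareIsSumOfThreeSmallerSquares (suc (2 ℕ.* h))
squareIsSumOfThreeSmallerSquares-oddPrime h p-prime = squareIsSumOfThreeSmallerSquares-odd h
  (prime-fourSquares-pairsPositive p-prime (isSumOfFourSquares-oddPrime h p-prime))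

squareIsSumOfThreeSmallerSquares-* : ∀ k {n} .{{_ : ℕ.NonZero k}} →
  SquareIsSumOfThreeSmallerSquares n → SquareIsSumOfThreeSmallerSquares (k ℕ.* n)
squareIsSumOfThreeSmallerSquares-* k {n} (x , y , z , x<n , y<n , z<n , eq) =
  + k * x , + k * y , + k * z , scale x<n , scale y<n , scale z<n , (begin
    (+ k * x) * (+ k * x) + (+ k * y) * (+ k * y) + (+ k * z) * (+ k * z)  ≡⟨ factor (+ k) x y z ⟩
    (+ k * + k) * (x * x + y * y + z * z)                                  ≡⟨ cong ((+ k * + k) *_) eq ⟩
    (+ k * + k) * (+ n * + n)                                              ≡⟨ regroup (+ k) (+ n) ⟩
    (+ k * + n) * (+ k * + n)                                              ≡⟨ cong₂ _*_ (ℤ.pos-* k n) (ℤ.pos-* k n) ⟨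
    + (k ℕ.* n) * + (k ℕ.* n)                                              ∎)
  where
  open ≡-Reasoning
  scale : ∀ {x} → ∣ x ∣ < n → ∣ + k * x ∣ < k ℕ.* n
  scale {x} x<n = subst (_< k ℕ.* n) (sym (ℤ.abs-* (+ k) x)) (ℕ.*-monoʳ-< k x<n)
  factor : ∀ k x y z → (k * x) * (k * x) + (k * y) * (k * y) + (k * z) * (k * z) ≡ (k * k) * (x * x + y * y + z * z)
  factor = solve-∀
  regroup : ∀ k n → (k * k) * (n * n) ≡ (k * n) * (k * n)
  regroup = solve-∀

-- Odd prime divisors

primeDivisor : ∀ n → 1 < n → ∃[ q ] Prime q × q ∣ n
primeDivisor n 1<n with factorise n {{ℕ.>-nonZero (ℕ.<-trans (s≤s z≤n) 1<n)}}
... | record { factors = [] ; isFactorisation = n≡1 } = ⊥-elim (ℕ.<-irrefl (sym n≡1) 1<n)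
... | record { factors = q ∷ qs ; isFactorisation = n≡q*qs ; factorsPrime = q-prime ∷ _ } =
  q , q-prime , divides (product qs) (trans n≡q*qs (ℕ.*-comm q (product qs)))

∣odd⇒odd : ∀ {q h} → q ∣ suc (2 ℕ.* h) → ∃[ k ] q ≡ suc (2 ℕ.* k)
∣odd⇒odd {q} {h} q∣n with even⊎oddℕ q
... | k , inj₂ q≡2k+1 = k , q≡2k+1
... | k , inj₁ refl with ∣-trans (divides k (ℕ.*-comm 2 k)) q∣n
...   | divides t n≡t*2 = ⊥-elim (ℕ.even≢odd t h (trans (ℕ.*-comm 2 t) (sym n≡t*2)))

HasOddPrimeDivisor : ℕ → Set
HasOddPrimeDivisor n = ∃[ h ] Prime (suc (2 ℕ.* h)) × suc (2 ℕ.* h) ∣ n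

oddPrimeDivisor : ∀ n → 0 < n → ¬ IsPowerOfTwo n → HasOddPrimeDivisor n
oddPrimeDivisor = <-rec _ step
  where
  step : ∀ n → (∀ {m} → m < n → 0 < m → ¬ IsPowerOfTwo m → HasOddPrimeDivisor m) →
         0 < n → ¬ IsPowerOfTwo n → HasOddPrimeDivisor n
  step n rec 0<n n≢2^ with even⊎oddℕ n
  ... | zero  , inj₁ refl = ⊥-elim (ℕ.<-irrefl refl 0<n)
  ... | suc k , inj₁ refl with rec {suc k} (ℕ.m<m+n (suc k) (s≤s z≤n)) (s≤s z≤n)
                                 (λ (j , k≡2^j) → n≢2^ (suc j , cong (2 ℕ.*_) k≡2^j))
  ...   | h , p-prime , p∣k = h , p-prime , ∣-trans p∣k (n∣m*n 2)
  step n rec 0<n n≢2^ | zero  , inj₂ refl = ⊥-elim (n≢2^ (0 , refl))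
  step n rec 0<n n≢2^ | suc g , inj₂ refl with primeDivisor n (s≤s (s≤s z≤n))
  ...   | q , q-prime , q∣n with ∣odd⇒odd {h = suc g} q∣n
  ...     | h , refl = h , q-prime , q∣n

lemma2p1 : (n : ℕ) → 0 < n → ¬ IsPowerOfTwo n →
    ∃[ x ] ∃[ y ] ∃[ z ] (∣ x ∣ < n × ∣ y ∣ < n × ∣ z ∣ < n ×
      x * x + y * y + z * z ≡ + n * + n)
lemma2p1 n 0<n n≢2^ with oddPrimeDivisor n 0<n n≢2^
... | h , p-prime , divides zero    refl = ⊥-elim (ℕ.<-irrefl refl 0<n)
... | h , p-prime , divides (suc q) refl =
  squareIsSumOfThreeSmallerSquares-* (suc q) (squareIsSumOfThreeSmallerSquares-oddPrime h p-prime)
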